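{- Let $S=\{0,\ldots,p-1\}$, $m\ge 1$ and $f:S^m\to S$. If there exist replaceable local configurations for $f$, then there exist periodic local configurations for $f$.
   Context: For a finite word $x=x_1\cdots x_n$ with $n\ge m$, its successor under $f$ is $f(x)=y_1\cdots y_{n-m+1}$ with $y_i=f(x_i\cdots x_{i+m-1})$; $\mathrm{left}_k(x)=x_1\cdots x_k$, $\mathrm{right}_k(x)=x_{n-k+1}\cdots x_n$. Finite words $\alpha,\beta$ are replaceable local configurations if each has length at least $2m-1$, $\alpha\ne\beta$, $\mathrm{left}_{m-1}(\alpha)=\mathrm{left}_{m-1}(\beta)$, $\mathrm{right}_{m-1}(\alpha)=\mathrm{right}_{m-1}(\beta)$, and $\alpha,\beta$ have the same successor under $f$. Finite words $\alpha,\beta$ are periodic local configurations if each has length at least $m$, $\alpha\ne\beta$, $\mathrm{left}_{m-1}(\alpha)=\mathrm{right}_{m-1}(\alpha)$, $\mathrm{left}_{m-1}(\beta)=\mathrm{right}_{m-1}(\beta)$, and $\alpha,\beta$ have the same successor under $f$. -}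

module Defs where

open import Data.Nat using (ℕ; zero; suc; _≤_; _∸_)
open import Data.Fin using (Fin)
open import Data.List using (List; []; _∷_; length; take; drop; reverse)
open import Data.Maybe using (Maybe; just; nothing)
open import Data.Vec using (Vec; []; _∷_)
open import Data.Product using (_×_)
open import Relation.Binary.PropositionalEquality using (_≡_)
open import Relation.Nullary using (¬_)

S : ℕ → Set
S p = Fin p

Rule : ℕ → ℕ → Set
Rule p m = Vec (S p) m → S p

Word : ℕ → Set
Word p = List (S p)

window : {A : Set} (m : ℕ) → List A → Maybe (Vec A m)
window zero    _        = just []
window (suc m) []       = nothing
window (suc m) (x ∷ xs) with window m xs
... | just v  = just (x ∷ v)
... | nothing = nothing

-- successor f(x) = y₁⋯y_{n-m+1}, yᵢ = f(xᵢ⋯x_{i+m-1});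
-- (for words shorter than m the result is [], but it is only used for length ≥ m)
successor : {p m : ℕ} → Rule p m → Word p → Word p
successor {m = m} f [] with window m ([] {A = S _})
... | just v  = f v ∷ []
... | nothing = []
successor {m = m} f (x ∷ xs) with window m (x ∷ xs)
... | just v  = f v ∷ successor f xs
... | nothing = []

left : {A : Set} → ℕ → List A → List A
left k x = take k x

right : {A : Set} → ℕ → List A → List A
right k x = drop (length x ∸ k) x

Replaceable : {p m : ℕ} → Rule p m → Word p → Word p → Set
Replaceable {m = m} f α β =
  (2 * m ∸ 1 ≤ length α) × (2 * m ∸ 1 ≤ length β) × ¬ (α ≡ β) ×
  (left (m ∸ 1) α ≡ left (m ∸ 1) β) × (right (m ∸ 1) α ≡ right (m ∸ 1) β) ×
  (successor f α ≡ successor f β)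
  where open import Data.Nat using (_*_)

Periodic : {p m : ℕ} → Rule p m → Word p → Word p → Set
Periodic {m = m} f α β =
  (m ≤ length α) × (m ≤ length β) × ¬ (α ≡ β) ×
  (left (m ∸ 1) α ≡ right (m ∸ 1) α) × (left (m ∸ 1) β ≡ right (m ∸ 1) β) ×
  (successor f α ≡ successor f β)

{-# OPTIONS --safe #-}
-- Append to both configurations the common prefix u of length m − 1. Since α and β
-- also share their suffix of length m − 1, the two resulting words begin and end
-- with u, i.e. they are periodic. Their successors are f(α) (resp. f(β)) followed by
-- the successor of right(α) u = right(β) u, so they still agree.
module Submission where

open import Defs
open import Data.Nat using (ℕ; _≥_; zero; suc; _≤_; _<_; _∸_; _*_; s≤s)
open import Data.Nat.Properties
open import Data.Product using (∃₂; _,_; Σ)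
open import Relation.Nullary using (yes; no)
open import Data.List using (List; []; _∷_; _++_; length; take; drop)
open import Data.List.Properties using (++-cancelʳ; length-++; length-take)
open import Data.Maybe using (just; nothing)
open import Data.Vec using (Vec; []; _∷_)
open import Relation.Binary.PropositionalEquality

module _ {A : Set} where

  window-++ : (k : ℕ) (xs ys : List A) → k ≤ length xs →
              window k (xs ++ ys) ≡ window k xs
  window-++ zero    xs       ys _         = refl
  window-++ (suc k) (x ∷ xs) ys (s≤s k≤) rewrite window-++ k xs ys k≤ = refl

  window-nothing : (k : ℕ) (xs : List A) → length xs < k → window k xs ≡ nothing
  window-nothing (suc k) []       _         = refl
  window-nothing (suc k) (x ∷ xs) (s≤s k>) rewrite window-nothing k xs k> = refl

  window-just : (k : ℕ) (xs : List A) → k ≤ length xs →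
                Σ (Vec A k) λ v → window k xs ≡ just v
  window-just zero    xs       _ = [] , refl
  window-just (suc k) (x ∷ xs) (s≤s k≤) with window-just k xs k≤
  ... | v , eq rewrite eq = x ∷ v , refl

  ≤-length-++ : {n : ℕ} (xs ys : List A) → n ≤ length xs → n ≤ length (xs ++ ys)
  ≤-length-++ xs ys n≤ = ≤-trans n≤ (≤-trans (m≤m+n _ _) (≤-reflexive (sym (length-++ xs))))

  take-++-≤ : (k : ℕ) (xs ys : List A) → k ≤ length xs → take k (xs ++ ys) ≡ take k xs
  take-++-≤ zero    xs       ys _         = refl
  take-++-≤ (suc k) (x ∷ xs) ys (s≤s k≤) = cong (x ∷_) (take-++-≤ k xs ys k≤)

  drop-length-++ : (xs ys : List A) → drop (length xs) (xs ++ ys) ≡ ys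
  drop-length-++ []       ys = refl
  drop-length-++ (x ∷ xs) ys = drop-length-++ xs ys

  right-∷ : (k : ℕ) (c : A) (xs : List A) → k ≤ length xs → right k (c ∷ xs) ≡ right k xs
  right-∷ k c xs k≤ rewrite +-∸-assoc 1 k≤ = refl

  right-length : (k : ℕ) (xs : List A) → length xs ≡ k → right k xs ≡ xs
  right-length k xs refl rewrite n∸n≡0 k = refl

  right-++ : (k : ℕ) (xs ys : List A) → length ys ≡ k → right k (xs ++ ys) ≡ ys
  right-++ k xs ys refl rewrite length-++ xs {ys} | m+n∸n≡m (length xs) k =
    drop-length-++ xs ys

  take≡right-++ : (k : ℕ) (xs u : List A) → k ≤ length xs → take k xs ≡ u →
                  length u ≡ k → take k (xs ++ u) ≡ right k (xs ++ u)
  take≡right-++ k xs u k≤ refl ∣u∣≡k =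
    trans (take-++-≤ k xs _ k≤) (sym (right-++ k xs _ ∣u∣≡k))

module _ {p k : ℕ} (f : Rule p (suc k)) where

  successor-∷ : (c : S p) (xs : Word p) (v : Vec (S p) (suc k)) →
                window (suc k) (c ∷ xs) ≡ just v → successor f (c ∷ xs) ≡ f v ∷ successor f xs
  successor-∷ c xs v eq with window (suc k) (c ∷ xs) | eq
  ... | .(just v) | refl = refl

  successor-short : (xs : Word p) → length xs ≤ k → successor f xs ≡ []
  successor-short []       _ = refl
  successor-short (c ∷ xs) ∣xs∣≤k
    with window (suc k) (c ∷ xs) | window-nothing (suc k) (c ∷ xs) (s≤s ∣xs∣≤k)
  ... | .nothing | refl = refl

  -- The windows of x ++ y are those of x, followed by those meeting y, which lie
  -- inside right k x ++ y.
  successor-++ : (x y : Word p) → k ≤ length x →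
                 successor f (x ++ y) ≡ successor f x ++ successor f (right k x ++ y)
  successor-++ [] y _ rewrite 0∸n≡0 k = refl
  successor-++ (c ∷ x) y k≤ with k ≤? length x
  ... | no k≰ = begin
      successor f (c ∷ x ++ y)
        ≡⟨ cong (λ z → successor f (z ++ y)) (sym (right-length k (c ∷ x) ∣cx∣≡k)) ⟩
      successor f (right k (c ∷ x) ++ y)
        ≡⟨ cong (_++ successor f (right k (c ∷ x) ++ y))
                (sym (successor-short (c ∷ x) (≤-reflexive ∣cx∣≡k))) ⟩
      successor f (c ∷ x) ++ successor f (right k (c ∷ x) ++ y) ∎
    where
      open ≡-Reasoning
      ∣cx∣≡k : suc (length x) ≡ k
      ∣cx∣≡k = ≤-antisym (≰⇒> k≰) k≤
  ... | yes k≤′ with window-just k x k≤′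
  ... | v , wx = begin
      successor f (c ∷ x ++ y)
        ≡⟨ successor-∷ c (x ++ y) (c ∷ v) window-cxy ⟩
      f (c ∷ v) ∷ successor f (x ++ y)
        ≡⟨ cong (f (c ∷ v) ∷_) (successor-++ x y k≤′) ⟩
      f (c ∷ v) ∷ successor f x ++ successor f (right k x ++ y)
        ≡⟨ cong (λ z → f (c ∷ v) ∷ successor f x ++ successor f (z ++ y))
                (sym (right-∷ k c x k≤′)) ⟩
      (f (c ∷ v) ∷ successor f x) ++ successor f (right k (c ∷ x) ++ y)
        ≡⟨ cong (_++ successor f (right k (c ∷ x) ++ y))
                (sym (successor-∷ c x (c ∷ v) window-cx)) ⟩
      successor f (c ∷ x) ++ successor f (right k (c ∷ x) ++ y) ∎
    where
      open ≡-Reasoning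
      window-cxy : window (suc k) (c ∷ x ++ y) ≡ just (c ∷ v)
      window-cxy rewrite window-++ k x y k≤′ | wx = refl
      window-cx : window (suc k) (c ∷ x) ≡ just (c ∷ v)
      window-cx rewrite wx = refl

  successor-++-cong : (x x′ y : Word p) → k ≤ length x → k ≤ length x′ →
                      successor f x ≡ successor f x′ → right k x ≡ right k x′ →
                      successor f (x ++ y) ≡ successor f (x′ ++ y)
  successor-++-cong x x′ y k≤ k≤′ fx≡fx′ rx≡rx′ = begin
    successor f (x ++ y)                             ≡⟨ successor-++ x y k≤ ⟩
    successor f x ++ successor f (right k x ++ y)    ≡⟨ cong₂ (λ s r → s ++ successor f (r ++ y))
                                                               fx≡fx′ rx≡rx′ ⟩
    successor f x′ ++ successor f (right k x′ ++ y)  ≡⟨ sym (successor-++ x′ y k≤′) ⟩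
    successor f (x′ ++ y)                            ∎
    where open ≡-Reasoning

lemma5 : (p m : ℕ) → m ≥ 1 → (f : Rule p m) →
    ∃₂ (λ α β → Replaceable f α β) → ∃₂ (λ α β → Periodic f α β)
lemma5 p (suc k) _ f (α , β , ∣α∣≥ , ∣β∣≥ , α≢β , leftα≡leftβ , rightα≡rightβ , fα≡fβ) =
  α ++ u , β ++ u ,
  ≤-length-++ α u m≤∣α∣ , ≤-length-++ β u m≤∣β∣ ,
  (λ eq → α≢β (++-cancelʳ u α β eq)) ,
  take≡right-++ k α u k≤∣α∣ refl ∣u∣≡k ,
  take≡right-++ k β u k≤∣β∣ (sym leftα≡leftβ) ∣u∣≡k ,
  successor-++-cong f α β u k≤∣α∣ k≤∣β∣ fα≡fβ rightα≡rightβ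
  where
    u : Word p
    u = take k α
    m≤2m∸1 : suc k ≤ 2 * suc k ∸ 1
    m≤2m∸1 = ≤-trans (s≤s (m≤m+n k 0)) (m≤n+m _ k)
    m≤∣α∣ : suc k ≤ length α
    m≤∣α∣ = ≤-trans m≤2m∸1 ∣α∣≥
    m≤∣β∣ : suc k ≤ length β
    m≤∣β∣ = ≤-trans m≤2m∸1 ∣β∣≥
    k≤∣α∣ : k ≤ length α
    k≤∣α∣ = ≤-trans (n≤1+n k) m≤∣α∣
    k≤∣β∣ : k ≤ length β
    k≤∣β∣ = ≤-trans (n≤1+n k) m≤∣β∣
    ∣u∣≡k : length u ≡ k
    ∣u∣≡k = trans (length-take k α) (m≤n⇒m⊓n≡m k≤∣α∣)
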